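{- Let $(\varphi_k)_{k\ge0}$ be a non-negative sequence with $\varphi_0>0$. For every $n\ge1$ there is a bijection $\mathcal{M}$ between the set $\mathcal{F}_n$ of ordered increasing diamonds with label set $\{1,\dots,n\}$ and the set $\mathcal{T}_n$ of ordered bucket increasing trees with maximal bucket size $b=2$ and label set $\{1,\dots,n\}$, such that $w(\mathcal{M}(F))=w(F)$ for all $F\in\mathcal{F}_n$, where diamond weights are defined from $(\varphi_k)$ and tree weights from $(\varphi_k)$ and $\psi_1=1$.
   Context: Ordered increasing diamonds are defined recursively on finite label sets $L\subset\mathbb{N}$: if $|L|=1$ the diamond is a single node carrying that label, with weight $1$; if $|L|\ge2$ a diamond consists of a source node labelled $\min L$, a sink node labelled $\max L$, and an ordered sequence $(F_1,\dots,F_r)$, $r\ge0$, of increasing diamonds whose label sets partition $L\setminus\{\min L,\max L\}$ (so $r=0$ iff $|L|=2$), with the source joined by edges to the source of each $F_i$ and the sink of each $F_i$ joined to the sink (for $r=0$ the source is joined to the sink); its weight is $\varphi_r\prod_{i=1}^r w(F_i)$. These are directed acyclic graphs with labels increasing along every directed path; the size is the number of nodes. Ordered bucket increasing trees with maximal bucket size $2$: rooted plane trees whose nodes are buckets of capacity $1$ or $2$, all internal nodes having capacity $2$ (saturated), with the labels $1,\dots,n$ distributed so each node holds $c(v)$ labels and labels increase along root-to-leaf paths; size is $\sum_v c(v)$. The weight is $\prod_v w(v)$ with $w(v)=\varphi_{\deg^+(v)}$ if $c(v)=2$ ($\deg^+$ = number of children) and $w(v)=\psi_1=1$ if $c(v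)=1$.
   Formalization: The sequence $(\varphi_k)$ takes values in the rationals, so the diamond and tree weights are rational. -}

module Defs where

open import Data.Bool using (Bool; true; false; _∧_; _∨_; T)
open import Data.Nat using (ℕ; zero; suc; _<ᵇ_; _≡ᵇ_)
open import Data.List using (List; []; _∷_; map; length; upTo; _++_)
open import Data.Product using (Σ)
open import Data.Rational using (ℚ; 1ℚ; _*_)

allB : {A : Set} → (A → Bool) → List A → Bool
allB p [] = true
allB p (x ∷ xs) = p x ∧ allB p xs

anyB : {A : Set} → (A → Bool) → List A → Bool
anyB p [] = false
anyB p (x ∷ xs) = p x ∨ anyB p xs

range : ℕ → List ℕ
range n = map suc (upTo n)

-- "the (multi)set of labels xs is exactly {1,...,n}, each label once":
-- xs has length n and every k ∈ {1..n} occurs in xs (hence xs is a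
-- permutation of [1..n], i.e. the labels are distinct and form {1..n}).
-- Stated as a Bool so that the predicate T (labelSetIs n xs) is a
-- proposition (unique proofs).
labelSetIs : ℕ → List ℕ → Bool
labelSetIs n xs = (length xs ≡ᵇ n) ∧ allB (λ k → anyB (λ x → k ≡ᵇ x) xs) (range n)

between : ℕ → ℕ → List ℕ → Bool
between a b = allB (λ x → (a <ᵇ x) ∧ (x <ᵇ b))

above : ℕ → List ℕ → Bool
above b = allB (λ x → b <ᵇ x)

prodℚ : List ℚ → ℚ
prodℚ [] = 1ℚ
prodℚ (x ∷ xs) = x * prodℚ xs

-- single a          : a one-node diamond with label a
-- diamond a b Fs    : source labelled a, sink labelled b, and the ordered
--                     sequence Fs = (F_1,...,F_r) of sub-diamonds
data Diamond : Set where
  single  : ℕ → Diamond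
  diamond : ℕ → ℕ → List Diamond → Diamond

labelsD  : Diamond → List ℕ
labelsDs : List Diamond → List ℕ
labelsD (single a) = a ∷ []
labelsD (diamond a b Fs) = a ∷ b ∷ labelsDs Fs
labelsDs [] = []
labelsDs (F ∷ Fs) = labelsD F ++ labelsDs Fs

-- Together with global distinctness of labels this says exactly that the
-- source is min L, the sink is max L and the label sets of the F_i
-- partition L \ {min L, max L}.
wfD  : Diamond → Bool
wfDs : ℕ → ℕ → List Diamond → Bool
wfD (single a) = true
wfD (diamond a b Fs) = (a <ᵇ b) ∧ wfDs a b Fs
wfDs a b [] = true
wfDs a b (F ∷ Fs) = wfD F ∧ between a b (labelsD F) ∧ wfDs a b Fs

wD  : (ℕ → ℚ) → Diamond → ℚ
wDs : (ℕ → ℚ) → List Diamond → ℚ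
wD φ (single a) = 1ℚ
wD φ (diamond a b Fs) = φ (length Fs) * wDs φ Fs
wDs φ [] = 1ℚ
wDs φ (F ∷ Fs) = wD φ F * wDs φ Fs

IsDiamondOn : ℕ → Diamond → Set
IsDiamondOn n F = T (wfD F ∧ labelSetIs n (labelsD F))

𝓕 : ℕ → Set
𝓕 n = Σ Diamond (IsDiamondOn n)

-- bucket1 a         : a node of capacity 1 holding label a (necessarily a
--                     leaf, since internal nodes are saturated)
-- bucket2 a b cs    : a node of capacity 2 holding labels a < b, with the
--                     ordered list cs of children (possibly empty)
data BTree : Set where
  bucket1 : ℕ → BTree
  bucket2 : ℕ → ℕ → List BTree → BTree

labelsT  : BTree → List ℕ
labelsTs : List BTree → List ℕ
labelsT (bucket1 a) = a ∷ []
labelsT (bucket2 a b cs) = a ∷ b ∷ labelsTs cs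
labelsTs [] = []
labelsTs (c ∷ cs) = labelsT c ++ labelsTs cs

wfT  : BTree → Bool
wfTs : ℕ → List BTree → Bool
wfT (bucket1 a) = true
wfT (bucket2 a b cs) = (a <ᵇ b) ∧ wfTs b cs
wfTs b [] = true
wfTs b (c ∷ cs) = wfT c ∧ above b (labelsT c) ∧ wfTs b cs

-- weight: ψ_1 = 1 for a capacity-1 node, φ_{outdeg} for a capacity-2 node
wT  : (ℕ → ℚ) → BTree → ℚ
wTs : (ℕ → ℚ) → List BTree → ℚ
wT φ (bucket1 a) = 1ℚ
wT φ (bucket2 a b cs) = φ (length cs) * wTs φ cs
wTs φ [] = 1ℚ
wTs φ (c ∷ cs) = wT φ c * wTs φ cs

IsTreeOn : ℕ → BTree → Set
IsTreeOn n t = T (wfT t ∧ labelSetIs n (labelsT t))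

𝓣 : ℕ → Set
𝓣 n = Σ BTree (IsTreeOn n)

{-# OPTIONS --safe #-}
-- A diamond and a bucket tree on a label set L have the same shapes; they differ
-- in what sits next to the minimum: the diamond pairs it with the sink max L, the
-- root bucket with the second smallest label. The bijection keeps the shape and
-- the source, puts the second smallest label of L into the root bucket, and
-- replaces every label of the sub-diamonds by its successor in L, recursively;
-- the successor of the largest inner label is the sink, so no label is lost. The
-- inverse replaces the labels below a bucket by their predecessors and takes the
-- largest label as the sink. Successor and predecessor commute with strictly
-- monotone relabellings, which is what lets the two recursions undo each other,
-- and out-degrees are never changed, so weights are preserved.
module Submission where

open import Defs
open import Data.Nat using (ℕ; _≤_)
open import Data.Product using (Σ; proj₁)
open import Data.Rational using (ℚ; 0ℚ) renaming (_≤_ to _≤ℚ_; _<_ to _<ℚ_)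
open import Function.Bundles using (_⤖_; Bijection)
open import Relation.Binary.PropositionalEquality using (_≡_)

open import Data.Bool using (Bool; T)
open import Data.Bool.Properties using (T-∧; T-∨; T-irrelevant)
open import Data.List using (List; []; _∷_; map; length; _++_)
open import Data.List.Extrema.Nat using (max; max≤v⁺; ⊥≤max; xs≤max; argmax-sel)
open import Data.List.Membership.Propositional using (_∈_)
open import Data.List.Membership.Propositional.Properties using (∈-map⁺; ∈-map⁻; ∈-++⁺ˡ; ∈-++⁺ʳ)
open import Data.List.Properties using (map-++; length-++; length-map)
open import Data.List.Relation.Binary.Subset.Propositional using (_⊆_)
import Data.List.Relation.Binary.Subset.Propositional.Properties as Subset
open import Data.List.Relation.Unary.All as All using (All; []; _∷_)
import Data.List.Relation.Unary.All.Properties as Allₚ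
open import Data.List.Relation.Unary.Any as Any using (here; there)
import Data.List.Relation.Unary.Any.Properties as Anyₚ
open import Data.Nat using (suc; _+_; _<_; _<ᵇ_; _≡ᵇ_)
open import Data.Nat.Properties
  using (<ᵇ⇒<; <⇒<ᵇ; ≡ᵇ⇒≡; ≡⇒≡ᵇ; <-isStrictTotalOrder; ≮⇒≥; ≤⇒≯; <⇒≤; <⇒≢; >⇒≢; <-irrefl;
         ≤-refl; ≤-antisym; <-trans; <-≤-trans; ≤-<-trans; m≤n⇒m<n∨m≡n)
open import Data.Product using (_×_; _,_; proj₂; uncurry)
open import Data.Product.Function.NonDependent.Propositional using (_×-⇔_)
open import Data.Rational using (_*_)
open import Data.Sum using (_⊎_; inj₁; inj₂)
open import Data.Sum.Function.Propositional using (_⊎-⇔_)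
open import Data.Unit using (⊤; tt)
open import Function using (id; _∘_; _⇔_; mk⇔; Equivalence; _↔_; mk↔ₛ′)
open import Function.Construct.Composition using (_⇔-∘_)
open import Function.Construct.Identity using (⇔-id)
open import Function.Properties.Inverse using (↔⇒⤖; ↔⇒⇔)
open import Relation.Binary using (IsStrictTotalOrder; tri<; tri≈; tri>)
import Relation.Binary.Construct.Flip.EqAndOrd as Flip
open import Relation.Binary.PropositionalEquality using (refl; sym; trans; cong; cong₂; subst; module ≡-Reasoning)
open import Relation.Nullary using (¬_; yes; no; contradiction)

open Equivalence using (to; from)

T-<ᵇ : ∀ {m n} → T (m <ᵇ n) ⇔ m < n
T-<ᵇ = mk⇔ (<ᵇ⇒< _ _) <⇒<ᵇ

T-≡ᵇ : ∀ {m n} → T (m ≡ᵇ n) ⇔ m ≡ n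
T-≡ᵇ = mk⇔ (≡ᵇ⇒≡ _ _) (≡⇒≡ᵇ _ _)

T-allB : ∀ {A : Set} {p : A → Bool} xs → T (allB p xs) ⇔ All (T ∘ p) xs
T-allB []       = mk⇔ (λ _ → []) (λ _ → tt)
T-allB (x ∷ xs) = mk⇔ (uncurry _∷_) All.uncons ⇔-∘ ((⇔-id _ ×-⇔ T-allB xs) ⇔-∘ T-∧)

T-anyB-≡ᵇ : ∀ {k} xs → T (anyB (k ≡ᵇ_) xs) ⇔ k ∈ xs
T-anyB-≡ᵇ []       = mk⇔ (λ ()) (λ ())
T-anyB-≡ᵇ (x ∷ xs) = ↔⇒⇔ (Anyₚ.∷↔ _) ⇔-∘ ((T-≡ᵇ ⊎-⇔ T-anyB-≡ᵇ xs) ⇔-∘ T-∨)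

All-⇔ : ∀ {A : Set} {P Q : A → Set} {xs} → (∀ {x} → P x ⇔ Q x) → All P xs ⇔ All Q xs
All-⇔ P⇔Q = mk⇔ (All.map (to P⇔Q)) (All.map (from P⇔Q))

T-labelSetIs : ∀ n xs → T (labelSetIs n xs) ⇔ (length xs ≡ n × All (_∈ xs) (range n))
T-labelSetIs n xs = (T-≡ᵇ ×-⇔ All-⇔ (λ {k} → T-anyB-≡ᵇ {k} xs) ⇔-∘ T-allB (range n)) ⇔-∘ T-∧

labelSetIs-⊆ : ∀ n {xs ys} → length xs ≡ length ys → xs ⊆ ys →
               T (labelSetIs n xs) → T (labelSetIs n ys)
labelSetIs-⊆ n {xs} {ys} |xs|≡|ys| xs⊆ys xs-on =
  let |xs|≡n , range⊆xs = to (T-labelSetIs n xs) xs-on in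
  from (T-labelSetIs n ys) (trans (sym |xs|≡|ys|) |xs|≡n , All.map xs⊆ys range⊆xs)

Between : ℕ → ℕ → List ℕ → Set
Between a b = All (λ x → a < x × x < b)

Above : ℕ → List ℕ → Set
Above c = All (c <_)

T-between : ∀ a b xs → T (between a b xs) ⇔ Between a b xs
T-between a b xs = All-⇔ ((T-<ᵇ ×-⇔ T-<ᵇ) ⇔-∘ T-∧) ⇔-∘ T-allB xs

T-above : ∀ c xs → T (above c xs) ⇔ Above c xs
T-above c xs = All-⇔ T-<ᵇ ⇔-∘ T-allB xs

WfD : Diamond → Set
WfDs : ℕ → ℕ → List Diamond → Set
WfD (single a) = ⊤
WfD (diamond a b Fs) = a < b × WfDs a b Fs
WfDs a b [] = ⊤
WfDs a b (F ∷ Fs) = WfD F × Between a b (labelsD F) × WfDs a b Fs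

WfT : BTree → Set
WfTs : ℕ → List BTree → Set
WfT (bucket1 a) = ⊤
WfT (bucket2 a c cs) = a < c × WfTs c cs
WfTs c [] = ⊤
WfTs c (t ∷ ts) = WfT t × Above c (labelsT t) × WfTs c ts

T-wfD : ∀ D → T (wfD D) ⇔ WfD D
T-wfDs : ∀ a b Fs → T (wfDs a b Fs) ⇔ WfDs a b Fs
T-wfD (single a) = ⇔-id ⊤
T-wfD (diamond a b Fs) = (T-<ᵇ ×-⇔ T-wfDs a b Fs) ⇔-∘ T-∧
T-wfDs a b [] = ⇔-id ⊤
T-wfDs a b (F ∷ Fs) = (T-wfD F ×-⇔ (T-between a b (labelsD F) ×-⇔ T-wfDs a b Fs) ⇔-∘ T-∧) ⇔-∘ T-∧

T-wfT : ∀ t → T (wfT t) ⇔ WfT t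
T-wfTs : ∀ c ts → T (wfTs c ts) ⇔ WfTs c ts
T-wfT (bucket1 a) = ⇔-id ⊤
T-wfT (bucket2 a c cs) = (T-<ᵇ ×-⇔ T-wfTs c cs) ⇔-∘ T-∧
T-wfTs c [] = ⇔-id ⊤
T-wfTs c (t ∷ ts) = (T-wfT t ×-⇔ (T-above c (labelsT t) ×-⇔ T-wfTs c ts) ⇔-∘ T-∧) ⇔-∘ T-∧

WfDs-between : ∀ {a b} Fs → WfDs a b Fs → Between a b (labelsDs Fs)
WfDs-between [] _ = []
WfDs-between (F ∷ Fs) (_ , btw , wfFs) = Allₚ.++⁺ btw (WfDs-between Fs wfFs)

WfTs-above : ∀ {c} ts → WfTs c ts → Above c (labelsTs ts)
WfTs-above [] _ = []
WfTs-above (t ∷ ts) (_ , abv , wfts) = Allₚ.++⁺ abv (WfTs-above ts wfts)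

module Neighbour {A : Set} {_≺_ : A → A → Set} (O : IsStrictTotalOrder _≡_ _≺_) where
  open IsStrictTotalOrder O using (_<?_; compare; irrefl; asym) renaming (trans to ≺-trans)

  ⊀-≺-trans : ∀ {a b c} → ¬ a ≺ c → a ≺ b → c ≺ b
  ⊀-≺-trans {b = b} {c} a⊀c a≺b with compare c b
  ... | tri< c≺b _ _ = c≺b
  ... | tri≈ _ refl _ = contradiction a≺b a⊀c
  ... | tri> _ _ b≺c = contradiction (≺-trans a≺b b≺c) a⊀c

  -- the least element of L above x, and x itself if there is none
  next : List A → A → A
  next [] x = x
  next (y ∷ L) x with x <? y | x <? next L x | y <? next L x
  ... | yes _ | no _  | _     = y
  ... | yes _ | yes _ | yes _ = y
  ... | _     | _     | _     = next L x

  IsLeastAbove : List A → A → A → Set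
  IsLeastAbove L x v = v ∈ L × x ≺ v × (∀ {w} → w ∈ L → x ≺ w → ¬ w ≺ v)

  NoneAbove : List A → A → Set
  NoneAbove L x = ∀ {w} → w ∈ L → ¬ x ≺ w

  next-spec : ∀ L x → IsLeastAbove L x (next L x) ⊎ (next L x ≡ x × NoneAbove L x)
  next-spec [] x = inj₂ (refl , λ ())
  next-spec (y ∷ L) x with x <? y | x <? next L x | y <? next L x | next-spec L x
  ... | yes x≺y | no x⊀r  | _       | inj₁ (_ , x≺r , _) = contradiction x≺r x⊀r
  ... | yes x≺y | no x⊀r  | _       | inj₂ (_ , none) =
    inj₁ (here refl , x≺y , λ { (here refl) _ → irrefl refl
                              ; (there w∈L) x≺w → contradiction x≺w (none w∈L) })
  ... | yes x≺y | yes x≺r | yes y≺r | inj₁ (_ , _ , least) =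
    inj₁ (here refl , x≺y , λ { (here refl) _ → irrefl refl
                              ; (there w∈L) x≺w w≺y → least w∈L x≺w (≺-trans w≺y y≺r) })
  ... | yes x≺y | yes x≺r | no y⊀r  | inj₁ (r∈L , _ , least) =
    inj₁ (there r∈L , x≺r , λ { (here refl) _ → y⊀r ; (there w∈L) → least w∈L })
  ... | yes _   | yes x≺r | _       | inj₂ (r≡x , _) = contradiction x≺r (irrefl (sym r≡x))
  ... | no x⊀y  | _       | _       | inj₁ (r∈L , x≺r , least) =
    inj₁ (there r∈L , x≺r , λ { (here refl) x≺y → contradiction x≺y x⊀y
                              ; (there w∈L) → least w∈L })
  ... | no x⊀y  | _       | _       | inj₂ (r≡x , none) =
    inj₂ (r≡x , λ { (here refl) → x⊀y ; (there w∈L) → none w∈L })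

  leastAbove-unique : ∀ {L x u v} → IsLeastAbove L x u → IsLeastAbove L x v → u ≡ v
  leastAbove-unique {u = u} {v} (u∈L , x≺u , u-least) (v∈L , x≺v , v-least) with compare u v
  ... | tri< u≺v _ _ = contradiction u≺v (v-least u∈L x≺u)
  ... | tri≈ _ u≡v _ = u≡v
  ... | tri> _ _ v≺u = contradiction v≺u (u-least v∈L x≺v)

  next-isLeastAbove : ∀ {L x z} → z ∈ L → x ≺ z → IsLeastAbove L x (next L x)
  next-isLeastAbove {L} {x} z∈L x≺z with next-spec L x
  ... | inj₁ least      = least
  ... | inj₂ (_ , none) = contradiction x≺z (none z∈L)

  module _ {L x z} (z∈L : z ∈ L) (x≺z : x ≺ z) where
    next-∈ : next L x ∈ L
    next-∈ = proj₁ (next-isLeastAbove z∈L x≺z)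

    next-> : x ≺ next L x
    next-> = proj₁ (proj₂ (next-isLeastAbove z∈L x≺z))

  next-least : ∀ {L x w} → w ∈ L → x ≺ w → ¬ w ≺ next L x
  next-least w∈L x≺w = proj₂ (proj₂ (next-isLeastAbove w∈L x≺w)) w∈L x≺w

  next-unique : ∀ {L x v} → IsLeastAbove L x v → next L x ≡ v
  next-unique v-least@(v∈L , x≺v , _) = leastAbove-unique (next-isLeastAbove v∈L x≺v) v-least

  next-cong : ∀ {L L′} → L ⊆ L′ → L′ ⊆ L → ∀ x → next L x ≡ next L′ x
  next-cong {L} {L′} L⊆L′ L′⊆L x with next-spec L x | next-spec L′ x
  ... | inj₁ (v∈L , x≺v , least) | _ =
    sym (next-unique (L⊆L′ v∈L , x≺v , λ w∈L′ → least (L′⊆L w∈L′)))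
  ... | inj₂ (_ , none) | inj₁ (v∈L′ , x≺v , _) = contradiction x≺v (none (L′⊆L v∈L′))
  ... | inj₂ (r≡x , _) | inj₂ (r′≡x , _) = trans r≡x (sym r′≡x)

  StrictlyMonotoneOn : (A → A) → List A → Set
  StrictlyMonotoneOn f S = ∀ {x y} → x ∈ S → y ∈ S → x ≺ y → f x ≺ f y

  strictlyMonotoneOn-⊆ : ∀ {f S S′} → S′ ⊆ S → StrictlyMonotoneOn f S → StrictlyMonotoneOn f S′
  strictlyMonotoneOn-⊆ S′⊆S f-mono x∈S′ y∈S′ = f-mono (S′⊆S x∈S′) (S′⊆S y∈S′)

  strictlyMonotoneOn-reflects : ∀ {f S x y} → StrictlyMonotoneOn f S →
                                x ∈ S → y ∈ S → f x ≺ f y → x ≺ y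
  strictlyMonotoneOn-reflects {x = x} {y} f-mono x∈S y∈S fx≺fy with compare x y
  ... | tri< x≺y _ _ = x≺y
  ... | tri≈ _ refl _ = contradiction fx≺fy (irrefl refl)
  ... | tri> _ _ y≺x = contradiction (f-mono y∈S x∈S y≺x) (asym fx≺fy)

  next-map : ∀ {f L x z} → StrictlyMonotoneOn f L → x ∈ L → z ∈ L → x ≺ z →
             next (map f L) (f x) ≡ f (next L x)
  next-map {f} {L} {x} f-mono x∈L z∈L x≺z =
    next-unique (∈-map⁺ f n∈L , f-mono x∈L n∈L (next-> z∈L x≺z) , least)
    where
    n∈L : next L x ∈ L
    n∈L = next-∈ z∈L x≺z
    least : ∀ {u} → u ∈ map f L → f x ≺ u → ¬ u ≺ f (next L x)
    least u∈fL fx≺u with ∈-map⁻ f u∈fL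
    ... | w , w∈L , refl = λ fw≺fn → next-least w∈L (f-reflects x∈L w∈L fx≺u) (f-reflects w∈L n∈L fw≺fn)
      where
      f-reflects : ∀ {x y} → x ∈ L → y ∈ L → f x ≺ f y → x ≺ y
      f-reflects = strictlyMonotoneOn-reflects f-mono

  next-strictlyMonotoneOn : ∀ {L S b} → b ∈ L → S ⊆ L → All (_≺ b) S → StrictlyMonotoneOn (next L) S
  next-strictlyMonotoneOn b∈L S⊆L S≺b x∈S y∈S x≺y =
    ⊀-≺-trans (next-least (S⊆L y∈S) x≺y) (next-> b∈L (All.lookup S≺b y∈S))

open Neighbour <-isStrictTotalOrder
module Prev = Neighbour (Flip.isStrictTotalOrder <-isStrictTotalOrder)
open Prev using () renaming (next to prev; next-∈ to prev-∈; next-> to prev-<)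

next-≤ : ∀ {L x w} → w ∈ L → x < w → next L x ≤ w
next-≤ w∈L x<w = ≮⇒≥ (next-least w∈L x<w)

≤-prev : ∀ {L x w} → w ∈ L → w < x → w ≤ prev L x
≤-prev w∈L w<x = ≮⇒≥ (Prev.next-least w∈L w<x)

prev-map : ∀ {f L y z} → StrictlyMonotoneOn f L → y ∈ L → z ∈ L → z < y →
           prev (map f L) (f y) ≡ f (prev L y)
prev-map f-mono = Prev.next-map (λ x∈L y∈L y<x → f-mono y∈L x∈L y<x)

prev-strictlyMonotoneOn : ∀ {L S c} → c ∈ L → S ⊆ L → All (c <_) S → StrictlyMonotoneOn (prev L) S
prev-strictlyMonotoneOn c∈L S⊆L c<S x∈S y∈S = Prev.next-strictlyMonotoneOn c∈L S⊆L c<S y∈S x∈S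

prev-next : ∀ {L x z} → x ∈ L → z ∈ L → x < z → prev L (next L x) ≡ x
prev-next x∈L z∈L x<z = Prev.next-unique (x∈L , next-> z∈L x<z , λ w∈L w<n x<w → next-least w∈L x<w w<n)

next-prev : ∀ {L y z} → y ∈ L → z ∈ L → z < y → next L (prev L y) ≡ y
next-prev y∈L z∈L z<y = next-unique (y∈L , prev-< z∈L z<y , λ w∈L p<w w<y → Prev.next-least w∈L w<y p<w)

strictlyMonotoneOn-≤ : ∀ {f S x y} → StrictlyMonotoneOn f S → x ∈ S → y ∈ S → x ≤ y → f x ≤ f y
strictlyMonotoneOn-≤ f-mono x∈S y∈S x≤y with m≤n⇒m<n∨m≡n x≤y
... | inj₁ x<y  = <⇒≤ (f-mono x∈S y∈S x<y)
... | inj₂ refl = ≤-refl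

∈⇒≤max : ∀ {v} ⊥ xs → v ∈ ⊥ ∷ xs → v ≤ max ⊥ xs
∈⇒≤max ⊥ xs (here refl) = ⊥≤max ⊥ xs
∈⇒≤max ⊥ xs (there v∈xs) = All.lookup (xs≤max ⊥ xs) v∈xs

max-∈ : ∀ ⊥ xs → max ⊥ xs ∈ ⊥ ∷ xs
max-∈ ⊥ xs with argmax-sel id ⊥ xs
... | inj₁ max≡⊥  = here max≡⊥
... | inj₂ max∈xs = there max∈xs

max-unique : ∀ {v ⊥ xs} → v ∈ ⊥ ∷ xs → All (_≤ v) (⊥ ∷ xs) → max ⊥ xs ≡ v
max-unique {⊥ = ⊥} {xs} v∈ (⊥≤v ∷ xs≤v) = ≤-antisym (max≤v⁺ ⊥≤v xs≤v) (∈⇒≤max ⊥ xs v∈)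

max-map : ∀ {f} ⊥ xs → StrictlyMonotoneOn f (⊥ ∷ xs) → max (f ⊥) (map f xs) ≡ f (max ⊥ xs)
max-map {f} ⊥ xs f-mono =
  max-unique (∈-map⁺ f (max-∈ ⊥ xs))
             (Allₚ.map⁺ (All.tabulate λ v∈ →
               strictlyMonotoneOn-≤ f-mono v∈ (max-∈ ⊥ xs) (∈⇒≤max ⊥ xs v∈)))

next-image : ∀ {a b R y} → y ∈ a ∷ b ∷ R → a < y → y ≤ b →
             y ∈ next (a ∷ b ∷ R) a ∷ map (next (a ∷ b ∷ R)) R
next-image {a} {b} {R} {y} y∈L a<y y≤b =
  subst (_∈ next L a ∷ map (next L) R) (next-prev y∈L (here refl) a<y)
        (predecessor-case (m≤n⇒m<n∨m≡n (≤-prev (here refl) a<y)))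
  where
  L = a ∷ b ∷ R
  predecessor-case : a < prev L y ⊎ a ≡ prev L y → next L (prev L y) ∈ next L a ∷ map (next L) R
  predecessor-case (inj₂ a≡p) = here (cong (next L) (sym a≡p))
  predecessor-case (inj₁ a<p) = there (∈-map⁺ (next L) p∈R)
    where
    p<b = <-≤-trans (prev-< (here refl) a<y) y≤b
    p∈R = Any.tail (<⇒≢ p<b) (Any.tail (>⇒≢ a<p) (prev-∈ (here refl) a<y))

⊆-next-image : ∀ {a b R} → a < b → Between a b R →
               a ∷ b ∷ R ⊆ a ∷ next (a ∷ b ∷ R) a ∷ map (next (a ∷ b ∷ R)) R
⊆-next-image _   _     (here refl)         = here refl
⊆-next-image a<b _     (there (here refl)) = there (next-image (there (here refl)) a<b ≤-refl)
⊆-next-image _   a<R<b (there (there y∈R)) =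
  let a<y , y<b = All.lookup a<R<b y∈R in there (next-image (there (there y∈R)) a<y (<⇒≤ y<b))

prev-image : ∀ {a c R y} → a < c → y ∈ a ∷ c ∷ R → c ≤ y → y < max c R →
             y ∈ map (prev (a ∷ c ∷ R)) R
prev-image {a} {c} {R} {y} a<c y∈L c≤y y<m =
  subst (_∈ map (prev L) R) (prev-next y∈L m∈L y<m) (∈-map⁺ (prev L) q∈R)
  where
  L = a ∷ c ∷ R
  m∈L = there (max-∈ c R)
  c<q = ≤-<-trans c≤y (next-> m∈L y<m)
  q∈R = Any.tail (>⇒≢ c<q) (Any.tail (>⇒≢ (<-trans a<c c<q)) (next-∈ m∈L y<m))

⊆-prev-image : ∀ {a c R} → a < c → Above c R → a ∷ c ∷ R ⊆ a ∷ max c R ∷ map (prev (a ∷ c ∷ R)) R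
⊆-prev-image _ _ (here refl) = here refl
⊆-prev-image {a} {c} {R} a<c c<R {y} (there y∈cR) with m≤n⇒m<n∨m≡n (∈⇒≤max c R y∈cR)
... | inj₂ y≡m = there (here y≡m)
... | inj₁ y<m = there (there (prev-image a<c (there y∈cR) (c≤ y∈cR) y<m))
  where
  c≤ : ∀ {z} → z ∈ c ∷ R → c ≤ z
  c≤ (here refl) = ≤-refl
  c≤ (there z∈R) = <⇒≤ (All.lookup c<R z∈R)

relabelD : (ℕ → ℕ) → Diamond → Diamond
relabelDs : (ℕ → ℕ) → List Diamond → List Diamond
relabelD f (single a) = single (f a)
relabelD f (diamond a b Fs) = diamond (f a) (f b) (relabelDs f Fs)
relabelDs f [] = []
relabelDs f (F ∷ Fs) = relabelD f F ∷ relabelDs f Fs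

relabelT : (ℕ → ℕ) → BTree → BTree
relabelTs : (ℕ → ℕ) → List BTree → List BTree
relabelT f (bucket1 a) = bucket1 (f a)
relabelT f (bucket2 a b cs) = bucket2 (f a) (f b) (relabelTs f cs)
relabelTs f [] = []
relabelTs f (t ∷ ts) = relabelT f t ∷ relabelTs f ts

labelsD-relabel : ∀ f D → labelsD (relabelD f D) ≡ map f (labelsD D)
labelsDs-relabel : ∀ f Fs → labelsDs (relabelDs f Fs) ≡ map f (labelsDs Fs)
labelsD-relabel f (single a) = refl
labelsD-relabel f (diamond a b Fs) = cong (λ xs → f a ∷ f b ∷ xs) (labelsDs-relabel f Fs)
labelsDs-relabel f [] = refl
labelsDs-relabel f (F ∷ Fs) =
  trans (cong₂ _++_ (labelsD-relabel f F) (labelsDs-relabel f Fs)) (sym (map-++ f (labelsD F) (labelsDs Fs)))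

labelsT-relabel : ∀ f t → labelsT (relabelT f t) ≡ map f (labelsT t)
labelsTs-relabel : ∀ f ts → labelsTs (relabelTs f ts) ≡ map f (labelsTs ts)
labelsT-relabel f (bucket1 a) = refl
labelsT-relabel f (bucket2 a b cs) = cong (λ xs → f a ∷ f b ∷ xs) (labelsTs-relabel f cs)
labelsTs-relabel f [] = refl
labelsTs-relabel f (t ∷ ts) =
  trans (cong₂ _++_ (labelsT-relabel f t) (labelsTs-relabel f ts)) (sym (map-++ f (labelsT t) (labelsTs ts)))

length-labelsD-relabel : ∀ f D → length (labelsD (relabelD f D)) ≡ length (labelsD D)
length-labelsD-relabel f D = trans (cong length (labelsD-relabel f D)) (length-map f (labelsD D))

length-labelsT-relabel : ∀ f t → length (labelsT (relabelT f t)) ≡ length (labelsT t)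
length-labelsT-relabel f t = trans (cong length (labelsT-relabel f t)) (length-map f (labelsT t))

relabelD-∘ : ∀ f g D → relabelD g (relabelD f D) ≡ relabelD (g ∘ f) D
relabelDs-∘ : ∀ f g Fs → relabelDs g (relabelDs f Fs) ≡ relabelDs (g ∘ f) Fs
relabelD-∘ f g (single a) = refl
relabelD-∘ f g (diamond a b Fs) = cong (diamond _ _) (relabelDs-∘ f g Fs)
relabelDs-∘ f g [] = refl
relabelDs-∘ f g (F ∷ Fs) = cong₂ _∷_ (relabelD-∘ f g F) (relabelDs-∘ f g Fs)

relabelT-∘ : ∀ f g t → relabelT g (relabelT f t) ≡ relabelT (g ∘ f) t
relabelTs-∘ : ∀ f g ts → relabelTs g (relabelTs f ts) ≡ relabelTs (g ∘ f) ts
relabelT-∘ f g (bucket1 a) = refl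
relabelT-∘ f g (bucket2 a b cs) = cong (bucket2 _ _) (relabelTs-∘ f g cs)
relabelTs-∘ f g [] = refl
relabelTs-∘ f g (t ∷ ts) = cong₂ _∷_ (relabelT-∘ f g t) (relabelTs-∘ f g ts)

relabelD-id : ∀ D → relabelD id D ≡ D
relabelDs-id : ∀ Fs → relabelDs id Fs ≡ Fs
relabelD-id (single a) = refl
relabelD-id (diamond a b Fs) = cong (diamond a b) (relabelDs-id Fs)
relabelDs-id [] = refl
relabelDs-id (F ∷ Fs) = cong₂ _∷_ (relabelD-id F) (relabelDs-id Fs)

relabelT-id : ∀ t → relabelT id t ≡ t
relabelTs-id : ∀ ts → relabelTs id ts ≡ ts
relabelT-id (bucket1 a) = refl
relabelT-id (bucket2 a b cs) = cong (bucket2 a b) (relabelTs-id cs)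
relabelTs-id [] = refl
relabelTs-id (t ∷ ts) = cong₂ _∷_ (relabelT-id t) (relabelTs-id ts)

relabelD-cong : ∀ {f g} D → (∀ {x} → x ∈ labelsD D → f x ≡ g x) → relabelD f D ≡ relabelD g D
relabelDs-cong : ∀ {f g} Fs → (∀ {x} → x ∈ labelsDs Fs → f x ≡ g x) → relabelDs f Fs ≡ relabelDs g Fs
relabelD-cong (single a) f≗g = cong single (f≗g (here refl))
relabelD-cong (diamond a b Fs) f≗g =
  cong₂ (λ (a′ , b′) → diamond a′ b′) (cong₂ _,_ (f≗g (here refl)) (f≗g (there (here refl))))
        (relabelDs-cong Fs (f≗g ∘ there ∘ there))
relabelDs-cong [] f≗g = refl
relabelDs-cong (F ∷ Fs) f≗g =
  cong₂ _∷_ (relabelD-cong F (f≗g ∘ ∈-++⁺ˡ)) (relabelDs-cong Fs (f≗g ∘ ∈-++⁺ʳ (labelsD F)))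

relabelT-cong : ∀ {f g} t → (∀ {x} → x ∈ labelsT t → f x ≡ g x) → relabelT f t ≡ relabelT g t
relabelTs-cong : ∀ {f g} ts → (∀ {x} → x ∈ labelsTs ts → f x ≡ g x) → relabelTs f ts ≡ relabelTs g ts
relabelT-cong (bucket1 a) f≗g = cong bucket1 (f≗g (here refl))
relabelT-cong (bucket2 a b cs) f≗g =
  cong₂ (λ (a′ , b′) → bucket2 a′ b′) (cong₂ _,_ (f≗g (here refl)) (f≗g (there (here refl))))
        (relabelTs-cong cs (f≗g ∘ there ∘ there))
relabelTs-cong [] f≗g = refl
relabelTs-cong (t ∷ ts) f≗g =
  cong₂ _∷_ (relabelT-cong t (f≗g ∘ ∈-++⁺ˡ)) (relabelTs-cong ts (f≗g ∘ ∈-++⁺ʳ (labelsT t)))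

between-map : ∀ {f S a b xs} → StrictlyMonotoneOn f S → a ∈ S → b ∈ S → xs ⊆ S →
              Between a b xs → Between (f a) (f b) (map f xs)
between-map f-mono a∈S b∈S xs⊆S a<xs<b = Allₚ.map⁺ (All.tabulate λ x∈xs →
  let a<x , x<b = All.lookup a<xs<b x∈xs in
  f-mono a∈S (xs⊆S x∈xs) a<x , f-mono (xs⊆S x∈xs) b∈S x<b)

above-map : ∀ {f S c xs} → StrictlyMonotoneOn f S → c ∈ S → xs ⊆ S → Above c xs → Above (f c) (map f xs)
above-map f-mono c∈S xs⊆S c<xs =
  Allₚ.map⁺ (All.tabulate λ x∈xs → f-mono c∈S (xs⊆S x∈xs) (All.lookup c<xs x∈xs))

relabelD-wf : ∀ {f} D → WfD D → StrictlyMonotoneOn f (labelsD D) → WfD (relabelD f D)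
relabelDs-wf : ∀ {f S a b} Fs → WfDs a b Fs → StrictlyMonotoneOn f S → a ∈ S → b ∈ S → labelsDs Fs ⊆ S →
               WfDs (f a) (f b) (relabelDs f Fs)
relabelD-wf (single a) _ _ = tt
relabelD-wf (diamond a b Fs) (a<b , wf) f-mono =
  f-mono (here refl) (there (here refl)) a<b , relabelDs-wf Fs wf f-mono (here refl) (there (here refl)) (there ∘ there)
relabelDs-wf [] _ _ _ _ _ = tt
relabelDs-wf {f} (F ∷ Fs) (wfF , btw , wfFs) f-mono a∈S b∈S FFs⊆S =
  relabelD-wf F wfF (strictlyMonotoneOn-⊆ F⊆S f-mono) ,
  subst (Between _ _) (sym (labelsD-relabel f F)) (between-map f-mono a∈S b∈S F⊆S btw) ,
  relabelDs-wf Fs wfFs f-mono a∈S b∈S (FFs⊆S ∘ ∈-++⁺ʳ (labelsD F))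
  where
  F⊆S : labelsD F ⊆ _
  F⊆S = FFs⊆S ∘ ∈-++⁺ˡ

relabelT-wf : ∀ {f} t → WfT t → StrictlyMonotoneOn f (labelsT t) → WfT (relabelT f t)
relabelTs-wf : ∀ {f S c} ts → WfTs c ts → StrictlyMonotoneOn f S → c ∈ S → labelsTs ts ⊆ S →
               WfTs (f c) (relabelTs f ts)
relabelT-wf (bucket1 a) _ _ = tt
relabelT-wf (bucket2 a c cs) (a<c , wf) f-mono =
  f-mono (here refl) (there (here refl)) a<c , relabelTs-wf cs wf f-mono (there (here refl)) (there ∘ there)
relabelTs-wf [] _ _ _ _ = tt
relabelTs-wf {f} (t ∷ ts) (wft , abv , wfts) f-mono c∈S tts⊆S =
  relabelT-wf t wft (strictlyMonotoneOn-⊆ t⊆S f-mono) ,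
  subst (Above _) (sym (labelsT-relabel f t)) (above-map f-mono c∈S t⊆S abv) ,
  relabelTs-wf ts wfts f-mono c∈S (tts⊆S ∘ ∈-++⁺ʳ (labelsT t))
  where
  t⊆S : labelsT t ⊆ _
  t⊆S = tts⊆S ∘ ∈-++⁺ˡ

length-relabelTs : ∀ f ts → length (relabelTs f ts) ≡ length ts
length-relabelTs f [] = refl
length-relabelTs f (t ∷ ts) = cong suc (length-relabelTs f ts)

wT-relabel : ∀ φ f t → wT φ (relabelT f t) ≡ wT φ t
wTs-relabel : ∀ φ f ts → wTs φ (relabelTs f ts) ≡ wTs φ ts
wT-relabel φ f (bucket1 a) = refl
wT-relabel φ f (bucket2 a b cs) = cong₂ _*_ (cong φ (length-relabelTs f cs)) (wTs-relabel φ f cs)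
wTs-relabel φ f [] = refl
wTs-relabel φ f (t ∷ ts) = cong₂ _*_ (wT-relabel φ f t) (wTs-relabel φ f ts)

toTree : Diamond → BTree
toTrees : (ℕ → ℕ) → List Diamond → List BTree
toTree (single a) = bucket1 a
toTree D@(diamond a b Fs) = bucket2 a (next (labelsD D) a) (toTrees (next (labelsD D)) Fs)
toTrees σ [] = []
toTrees σ (F ∷ Fs) = relabelT σ (toTree F) ∷ toTrees σ Fs

fromTree : BTree → Diamond
fromTrees : (ℕ → ℕ) → List BTree → List Diamond
fromTree (bucket1 a) = single a
fromTree t@(bucket2 a c cs) = diamond a (max c (labelsTs cs)) (fromTrees (prev (labelsT t)) cs)
fromTrees π [] = []
fromTrees π (t ∷ ts) = relabelD π (fromTree t) ∷ fromTrees π ts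

toTree-⊆ : ∀ D → WfD D → labelsT (toTree D) ⊆ labelsD D
toTrees-⊆ : ∀ {a b} σ Fs → WfDs a b Fs → labelsTs (toTrees σ Fs) ⊆ map σ (labelsDs Fs)
toTree-⊆ (single a) _ = id
toTree-⊆ (diamond a b Fs) _ (here refl) = here refl
toTree-⊆ (diamond a b Fs) (a<b , _) (there (here refl)) = next-∈ (there (here refl)) a<b
toTree-⊆ D@(diamond a b Fs) (_ , wf) (there (there y∈)) with ∈-map⁻ (next (labelsD D)) (toTrees-⊆ _ Fs wf y∈)
... | x , x∈Fs , refl = next-∈ (there (here refl)) (proj₂ (All.lookup (WfDs-between Fs wf) x∈Fs))
toTrees-⊆ σ [] _ = id
toTrees-⊆ σ (F ∷ Fs) (wfF , _ , wfFs) = begin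
  labelsT (relabelT σ (toTree F)) ++ labelsTs (toTrees σ Fs)
    ≡⟨ cong (_++ _) (labelsT-relabel σ (toTree F)) ⟩
  map σ (labelsT (toTree F)) ++ labelsTs (toTrees σ Fs)
    ⊆⟨ Subset.++⁺ (Subset.map⁺ σ (toTree-⊆ F wfF)) (toTrees-⊆ σ Fs wfFs) ⟩
  map σ (labelsD F) ++ map σ (labelsDs Fs)
    ≡⟨ map-++ σ (labelsD F) (labelsDs Fs) ⟨
  map σ (labelsD F ++ labelsDs Fs)
    ∎
  where open Subset.⊆-Reasoning ℕ

toTree-⊇ : ∀ D → WfD D → labelsD D ⊆ labelsT (toTree D)
toTrees-⊇ : ∀ {a b} σ Fs → WfDs a b Fs → map σ (labelsDs Fs) ⊆ labelsTs (toTrees σ Fs)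
toTree-⊇ (single a) _ = id
toTree-⊇ D@(diamond a b Fs) (a<b , wf) =
  Subset.∷⁺ʳ a (Subset.∷⁺ʳ _ (toTrees-⊇ (next (labelsD D)) Fs wf)) ∘ ⊆-next-image a<b (WfDs-between Fs wf)
toTrees-⊇ σ [] _ = id
toTrees-⊇ σ (F ∷ Fs) (wfF , _ , wfFs) = begin
  map σ (labelsD F ++ labelsDs Fs)
    ≡⟨ map-++ σ (labelsD F) (labelsDs Fs) ⟩
  map σ (labelsD F) ++ map σ (labelsDs Fs)
    ⊆⟨ Subset.++⁺ (Subset.map⁺ σ (toTree-⊇ F wfF)) (toTrees-⊇ σ Fs wfFs) ⟩
  map σ (labelsT (toTree F)) ++ labelsTs (toTrees σ Fs)
    ≡⟨ cong (_++ _) (labelsT-relabel σ (toTree F)) ⟨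
  labelsT (relabelT σ (toTree F)) ++ labelsTs (toTrees σ Fs)
    ∎
  where open Subset.⊆-Reasoning ℕ

fromTree-⊆ : ∀ t → WfT t → labelsD (fromTree t) ⊆ labelsT t
fromTrees-⊆ : ∀ {c} π ts → WfTs c ts → labelsDs (fromTrees π ts) ⊆ map π (labelsTs ts)
fromTree-⊆ (bucket1 a) _ = id
fromTree-⊆ (bucket2 a c cs) _ (here refl) = here refl
fromTree-⊆ (bucket2 a c cs) _ (there (here refl)) = there (max-∈ c (labelsTs cs))
fromTree-⊆ t@(bucket2 a c cs) (_ , wf) (there (there y∈)) with ∈-map⁻ (prev (labelsT t)) (fromTrees-⊆ _ cs wf y∈)
... | x , x∈cs , refl = prev-∈ (there (here refl)) (All.lookup (WfTs-above cs wf) x∈cs)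
fromTrees-⊆ π [] _ = id
fromTrees-⊆ π (t ∷ ts) (wft , _ , wfts) = begin
  labelsD (relabelD π (fromTree t)) ++ labelsDs (fromTrees π ts)
    ≡⟨ cong (_++ _) (labelsD-relabel π (fromTree t)) ⟩
  map π (labelsD (fromTree t)) ++ labelsDs (fromTrees π ts)
    ⊆⟨ Subset.++⁺ (Subset.map⁺ π (fromTree-⊆ t wft)) (fromTrees-⊆ π ts wfts) ⟩
  map π (labelsT t) ++ map π (labelsTs ts)
    ≡⟨ map-++ π (labelsT t) (labelsTs ts) ⟨
  map π (labelsT t ++ labelsTs ts)
    ∎
  where open Subset.⊆-Reasoning ℕ

fromTree-⊇ : ∀ t → WfT t → labelsT t ⊆ labelsD (fromTree t)
fromTrees-⊇ : ∀ {c} π ts → WfTs c ts → map π (labelsTs ts) ⊆ labelsDs (fromTrees π ts)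
fromTree-⊇ (bucket1 a) _ = id
fromTree-⊇ t@(bucket2 a c cs) (a<c , wf) =
  Subset.∷⁺ʳ a (Subset.∷⁺ʳ _ (fromTrees-⊇ (prev (labelsT t)) cs wf)) ∘ ⊆-prev-image a<c (WfTs-above cs wf)
fromTrees-⊇ π [] _ = id
fromTrees-⊇ π (t ∷ ts) (wft , _ , wfts) = begin
  map π (labelsT t ++ labelsTs ts)
    ≡⟨ map-++ π (labelsT t) (labelsTs ts) ⟩
  map π (labelsT t) ++ map π (labelsTs ts)
    ⊆⟨ Subset.++⁺ (Subset.map⁺ π (fromTree-⊇ t wft)) (fromTrees-⊇ π ts wfts) ⟩
  map π (labelsD (fromTree t)) ++ labelsDs (fromTrees π ts)
    ≡⟨ cong (_++ _) (labelsD-relabel π (fromTree t)) ⟨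
  labelsD (relabelD π (fromTree t)) ++ labelsDs (fromTrees π ts)
    ∎
  where open Subset.⊆-Reasoning ℕ

length-labelsT-toTree : ∀ D → length (labelsT (toTree D)) ≡ length (labelsD D)
length-labelsTs-toTrees : ∀ σ Fs → length (labelsTs (toTrees σ Fs)) ≡ length (labelsDs Fs)
length-labelsT-toTree (single a) = refl
length-labelsT-toTree (diamond a b Fs) = cong (suc ∘ suc) (length-labelsTs-toTrees _ Fs)
length-labelsTs-toTrees σ [] = refl
length-labelsTs-toTrees σ (F ∷ Fs) = begin
  length (labelsT (relabelT σ (toTree F)) ++ labelsTs (toTrees σ Fs))
    ≡⟨ length-++ (labelsT (relabelT σ (toTree F))) ⟩
  length (labelsT (relabelT σ (toTree F))) + length (labelsTs (toTrees σ Fs))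
    ≡⟨ cong₂ _+_ (trans (length-labelsT-relabel σ (toTree F)) (length-labelsT-toTree F))
                 (length-labelsTs-toTrees σ Fs) ⟩
  length (labelsD F) + length (labelsDs Fs)
    ≡⟨ length-++ (labelsD F) ⟨
  length (labelsD F ++ labelsDs Fs)
    ∎
  where open ≡-Reasoning

length-labelsD-fromTree : ∀ t → length (labelsD (fromTree t)) ≡ length (labelsT t)
length-labelsDs-fromTrees : ∀ π ts → length (labelsDs (fromTrees π ts)) ≡ length (labelsTs ts)
length-labelsD-fromTree (bucket1 a) = refl
length-labelsD-fromTree (bucket2 a c cs) = cong (suc ∘ suc) (length-labelsDs-fromTrees _ cs)
length-labelsDs-fromTrees π [] = refl
length-labelsDs-fromTrees π (t ∷ ts) = begin
  length (labelsD (relabelD π (fromTree t)) ++ labelsDs (fromTrees π ts))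
    ≡⟨ length-++ (labelsD (relabelD π (fromTree t))) ⟩
  length (labelsD (relabelD π (fromTree t))) + length (labelsDs (fromTrees π ts))
    ≡⟨ cong₂ _+_ (trans (length-labelsD-relabel π (fromTree t)) (length-labelsD-fromTree t))
                 (length-labelsDs-fromTrees π ts) ⟩
  length (labelsT t) + length (labelsTs ts)
    ≡⟨ length-++ (labelsT t) ⟨
  length (labelsT t ++ labelsTs ts)
    ∎
  where open ≡-Reasoning

toTree-wf : ∀ D → WfD D → WfT (toTree D)
toTrees-wf : ∀ {a b s σ} Fs → WfDs a b Fs → StrictlyMonotoneOn σ (labelsDs Fs) →
             All (λ x → s < σ x) (labelsDs Fs) → WfTs s (toTrees σ Fs)
toTree-wf (single a) _ = tt
toTree-wf D@(diamond a b Fs) (a<b , wf) =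
  next-> b∈D a<b ,
  toTrees-wf Fs wf (next-strictlyMonotoneOn b∈D (there ∘ there) (All.map proj₂ a<Fs<b))
             (All.tabulate λ x∈Fs → let a<x , x<b = All.lookup a<Fs<b x∈Fs in
                                    ≤-<-trans (next-≤ (there (there x∈Fs)) a<x) (next-> b∈D x<b))
  where
  b∈D : b ∈ labelsD D
  b∈D = there (here refl)
  a<Fs<b = WfDs-between Fs wf
toTrees-wf [] _ _ _ = tt
toTrees-wf {σ = σ} (F ∷ Fs) (wfF , _ , wfFs) σ-mono s<σ =
  relabelT-wf (toTree F) (toTree-wf F wfF) (strictlyMonotoneOn-⊆ toTreeF⊆ σ-mono) ,
  subst (Above _) (sym (labelsT-relabel σ (toTree F))) (Allₚ.map⁺ (Subset.All-resp-⊇ toTreeF⊆ s<σ)) ,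
  toTrees-wf Fs wfFs (strictlyMonotoneOn-⊆ (∈-++⁺ʳ (labelsD F)) σ-mono) (Allₚ.++⁻ʳ (labelsD F) s<σ)
  where
  toTreeF⊆ : labelsT (toTree F) ⊆ labelsDs (F ∷ Fs)
  toTreeF⊆ = ∈-++⁺ˡ ∘ toTree-⊆ F wfF

fromTree-wf : ∀ t → WfT t → WfD (fromTree t)
fromTrees-wf : ∀ {a c m π} ts → WfTs c ts → StrictlyMonotoneOn π (labelsTs ts) →
               All (λ x → a < π x × π x < m) (labelsTs ts) → WfDs a m (fromTrees π ts)
fromTree-wf (bucket1 a) _ = tt
fromTree-wf t@(bucket2 a c cs) (a<c , wf) =
  <-≤-trans a<c (⊥≤max c (labelsTs cs)) ,
  fromTrees-wf cs wf (prev-strictlyMonotoneOn c∈t (there ∘ there) c<cs)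
               (All.tabulate λ x∈cs → let c<x = All.lookup c<cs x∈cs in
                                      <-≤-trans a<c (≤-prev c∈t c<x) ,
                                      <-≤-trans (prev-< c∈t c<x) (∈⇒≤max c (labelsTs cs) (there x∈cs)))
  where
  c∈t : c ∈ labelsT t
  c∈t = there (here refl)
  c<cs = WfTs-above cs wf
fromTrees-wf [] _ _ _ = tt
fromTrees-wf {π = π} (t ∷ ts) (wft , _ , wfts) π-mono bounds =
  relabelD-wf (fromTree t) (fromTree-wf t wft) (strictlyMonotoneOn-⊆ fromTreet⊆ π-mono) ,
  subst (Between _ _) (sym (labelsD-relabel π (fromTree t))) (Allₚ.map⁺ (Subset.All-resp-⊇ fromTreet⊆ bounds)) ,
  fromTrees-wf ts wfts (strictlyMonotoneOn-⊆ (∈-++⁺ʳ (labelsT t)) π-mono) (Allₚ.++⁻ʳ (labelsT t) bounds)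
  where
  fromTreet⊆ : labelsD (fromTree t) ⊆ labelsTs (t ∷ ts)
  fromTreet⊆ = ∈-++⁺ˡ ∘ fromTree-⊆ t wft

toTree-relabel : ∀ {f} D → WfD D → StrictlyMonotoneOn f (labelsD D) →
                 toTree (relabelD f D) ≡ relabelT f (toTree D)
toTrees-relabel : ∀ {f σ τ a b} Fs → WfDs a b Fs → StrictlyMonotoneOn f (labelsDs Fs) →
                  (∀ {x} → x ∈ labelsDs Fs → τ (f x) ≡ f (σ x)) →
                  toTrees τ (relabelDs f Fs) ≡ relabelTs f (toTrees σ Fs)
toTree-relabel (single a) _ _ = refl
toTree-relabel {f} D@(diamond a b Fs) (a<b , wf) f-mono =
  cong₂ (bucket2 (f a)) (next-relabel (here refl) a<b)
        (toTrees-relabel Fs wf (strictlyMonotoneOn-⊆ (there ∘ there) f-mono)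
                         (λ x∈Fs → next-relabel (there (there x∈Fs)) (proj₂ (All.lookup (WfDs-between Fs wf) x∈Fs))))
  where
  next-relabel : ∀ {x} → x ∈ labelsD D → x < b → next (labelsD (relabelD f D)) (f x) ≡ f (next (labelsD D) x)
  next-relabel {x} x∈D x<b =
    trans (cong (λ L → next L (f x)) (labelsD-relabel f D)) (next-map f-mono x∈D (there (here refl)) x<b)
toTrees-relabel [] _ _ _ = refl
toTrees-relabel {f} {σ} {τ} (F ∷ Fs) (wfF , _ , wfFs) f-mono τf≗fσ =
  cong₂ _∷_ child (toTrees-relabel Fs wfFs (strictlyMonotoneOn-⊆ Fs⊆ f-mono) (τf≗fσ ∘ Fs⊆))
  where
  Fs⊆ : labelsDs Fs ⊆ labelsDs (F ∷ Fs)
  Fs⊆ = ∈-++⁺ʳ (labelsD F)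
  open ≡-Reasoning
  child : relabelT τ (toTree (relabelD f F)) ≡ relabelT f (relabelT σ (toTree F))
  child = begin
    relabelT τ (toTree (relabelD f F))
      ≡⟨ cong (relabelT τ) (toTree-relabel F wfF (strictlyMonotoneOn-⊆ ∈-++⁺ˡ f-mono)) ⟩
    relabelT τ (relabelT f (toTree F)) ≡⟨ relabelT-∘ f τ (toTree F) ⟩
    relabelT (τ ∘ f) (toTree F)
      ≡⟨ relabelT-cong (toTree F) (τf≗fσ ∘ ∈-++⁺ˡ ∘ toTree-⊆ F wfF) ⟩
    relabelT (f ∘ σ) (toTree F)        ≡⟨ relabelT-∘ σ f (toTree F) ⟨
    relabelT f (relabelT σ (toTree F)) ∎

fromTree-relabel : ∀ {f} t → WfT t → StrictlyMonotoneOn f (labelsT t) →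
                   fromTree (relabelT f t) ≡ relabelD f (fromTree t)
fromTrees-relabel : ∀ {f π ρ c} ts → WfTs c ts → StrictlyMonotoneOn f (labelsTs ts) →
                    (∀ {x} → x ∈ labelsTs ts → ρ (f x) ≡ f (π x)) →
                    fromTrees ρ (relabelTs f ts) ≡ relabelDs f (fromTrees π ts)
fromTree-relabel (bucket1 a) _ _ = refl
fromTree-relabel {f} t@(bucket2 a c cs) (a<c , wf) f-mono =
  cong₂ (diamond (f a))
        (trans (cong (max (f c)) (labelsTs-relabel f cs)) (max-map c (labelsTs cs) (strictlyMonotoneOn-⊆ there f-mono)))
        (fromTrees-relabel cs wf (strictlyMonotoneOn-⊆ (there ∘ there) f-mono)
                           (λ x∈cs → prev-relabel (there (there x∈cs)) (All.lookup (WfTs-above cs wf) x∈cs)))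
  where
  prev-relabel : ∀ {x} → x ∈ labelsT t → c < x → prev (labelsT (relabelT f t)) (f x) ≡ f (prev (labelsT t) x)
  prev-relabel {x} x∈t c<x =
    trans (cong (λ L → prev L (f x)) (labelsT-relabel f t)) (prev-map f-mono x∈t (there (here refl)) c<x)
fromTrees-relabel [] _ _ _ = refl
fromTrees-relabel {f} {π} {ρ} (t ∷ ts) (wft , _ , wfts) f-mono ρf≗fπ =
  cong₂ _∷_ child (fromTrees-relabel ts wfts (strictlyMonotoneOn-⊆ ts⊆ f-mono) (ρf≗fπ ∘ ts⊆))
  where
  ts⊆ : labelsTs ts ⊆ labelsTs (t ∷ ts)
  ts⊆ = ∈-++⁺ʳ (labelsT t)
  open ≡-Reasoning
  child : relabelD ρ (fromTree (relabelT f t)) ≡ relabelD f (relabelD π (fromTree t))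
  child = begin
    relabelD ρ (fromTree (relabelT f t))
      ≡⟨ cong (relabelD ρ) (fromTree-relabel t wft (strictlyMonotoneOn-⊆ ∈-++⁺ˡ f-mono)) ⟩
    relabelD ρ (relabelD f (fromTree t)) ≡⟨ relabelD-∘ f ρ (fromTree t) ⟩
    relabelD (ρ ∘ f) (fromTree t)
      ≡⟨ relabelD-cong (fromTree t) (ρf≗fπ ∘ ∈-++⁺ˡ ∘ fromTree-⊆ t wft) ⟩
    relabelD (f ∘ π) (fromTree t)        ≡⟨ relabelD-∘ π f (fromTree t) ⟨
    relabelD f (relabelD π (fromTree t)) ∎

fromTree-toTree : ∀ D → WfD D → fromTree (toTree D) ≡ D
fromTrees-toTrees : ∀ {a b π σ} Fs → WfDs a b Fs → StrictlyMonotoneOn σ (labelsDs Fs) →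
                    (∀ {x} → x ∈ labelsDs Fs → π (σ x) ≡ x) → fromTrees π (toTrees σ Fs) ≡ Fs
fromTree-toTree (single a) _ = refl
fromTree-toTree D@(diamond a b Fs) wfD@(a<b , wf) =
  cong₂ (diamond a) sink≡b
        (fromTrees-toTrees Fs wf (next-strictlyMonotoneOn b∈D (there ∘ there) (All.map proj₂ a<Fs<b)) prev∘next≗id)
  where
  L = labelsD D
  b∈D : b ∈ L
  b∈D = there (here refl)
  a<Fs<b = WfDs-between Fs wf
  ≤b : All (_≤ b) (labelsT (toTree D))
  ≤b = Subset.All-resp-⊇ (toTree-⊆ D wfD) (<⇒≤ a<b ∷ ≤-refl ∷ All.map (<⇒≤ ∘ proj₂) a<Fs<b)
  sink≡b : max (next L a) (labelsTs (toTrees (next L) Fs)) ≡ b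
  sink≡b = max-unique (Any.tail (>⇒≢ a<b) (toTree-⊇ D wfD b∈D)) (All.tail ≤b)
  prev∘next≗id : ∀ {x} → x ∈ labelsDs Fs → prev (labelsT (toTree D)) (next L x) ≡ x
  prev∘next≗id {x} x∈Fs =
    trans (sym (Prev.next-cong (toTree-⊇ D wfD) (toTree-⊆ D wfD) (next L x)))
          (prev-next (there (there x∈Fs)) b∈D (proj₂ (All.lookup a<Fs<b x∈Fs)))
fromTrees-toTrees [] _ _ _ = refl
fromTrees-toTrees {π = π} {σ} (F ∷ Fs) (wfF , _ , wfFs) σ-mono π∘σ≗id =
  cong₂ _∷_ child (fromTrees-toTrees Fs wfFs (strictlyMonotoneOn-⊆ Fs⊆ σ-mono) (π∘σ≗id ∘ Fs⊆))
  where
  Fs⊆ : labelsDs Fs ⊆ labelsDs (F ∷ Fs)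
  Fs⊆ = ∈-++⁺ʳ (labelsD F)
  open ≡-Reasoning
  child : relabelD π (fromTree (relabelT σ (toTree F))) ≡ F
  child = begin
    relabelD π (fromTree (relabelT σ (toTree F)))
      ≡⟨ cong (relabelD π) (fromTree-relabel (toTree F) (toTree-wf F wfF)
                                             (strictlyMonotoneOn-⊆ (∈-++⁺ˡ ∘ toTree-⊆ F wfF) σ-mono)) ⟩
    relabelD π (relabelD σ (fromTree (toTree F))) ≡⟨ cong (relabelD π ∘ relabelD σ) (fromTree-toTree F wfF) ⟩
    relabelD π (relabelD σ F)                     ≡⟨ relabelD-∘ σ π F ⟩
    relabelD (π ∘ σ) F                            ≡⟨ relabelD-cong F (π∘σ≗id ∘ ∈-++⁺ˡ) ⟩
    relabelD id F                                 ≡⟨ relabelD-id F ⟩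
    F                                             ∎

toTree-fromTree : ∀ t → WfT t → toTree (fromTree t) ≡ t
toTrees-fromTrees : ∀ {c σ π} ts → WfTs c ts → StrictlyMonotoneOn π (labelsTs ts) →
                    (∀ {x} → x ∈ labelsTs ts → σ (π x) ≡ x) → toTrees σ (fromTrees π ts) ≡ ts
toTree-fromTree (bucket1 a) _ = refl
toTree-fromTree t@(bucket2 a c cs) wft@(a<c , wf) =
  cong₂ (bucket2 a) second≡c
        (toTrees-fromTrees cs wf (prev-strictlyMonotoneOn c∈t (there ∘ there) c<cs) next∘prev≗id)
  where
  L = labelsT t
  D = fromTree t
  c∈t : c ∈ L
  c∈t = there (here refl)
  c<cs = WfTs-above cs wf
  c≤ : ∀ {w} → w ∈ L → a < w → c ≤ w
  c≤ (here refl) a<a = contradiction a<a (<-irrefl refl)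
  c≤ (there (here refl)) _ = ≤-refl
  c≤ (there (there w∈cs)) _ = <⇒≤ (All.lookup c<cs w∈cs)
  second≡c : next (labelsD D) a ≡ c
  second≡c = next-unique (fromTree-⊇ t wft c∈t , a<c , λ w∈D a<w → ≤⇒≯ (c≤ (fromTree-⊆ t wft w∈D) a<w))
  next∘prev≗id : ∀ {x} → x ∈ labelsTs cs → next (labelsD D) (prev L x) ≡ x
  next∘prev≗id {x} x∈cs =
    trans (sym (next-cong (fromTree-⊇ t wft) (fromTree-⊆ t wft) (prev L x)))
          (next-prev (there (there x∈cs)) c∈t (All.lookup c<cs x∈cs))
toTrees-fromTrees [] _ _ _ = refl
toTrees-fromTrees {σ = σ} {π} (t ∷ ts) (wft , _ , wfts) π-mono σ∘π≗id =
  cong₂ _∷_ child (toTrees-fromTrees ts wfts (strictlyMonotoneOn-⊆ ts⊆ π-mono) (σ∘π≗id ∘ ts⊆))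
  where
  ts⊆ : labelsTs ts ⊆ labelsTs (t ∷ ts)
  ts⊆ = ∈-++⁺ʳ (labelsT t)
  open ≡-Reasoning
  child : relabelT σ (toTree (relabelD π (fromTree t))) ≡ t
  child = begin
    relabelT σ (toTree (relabelD π (fromTree t)))
      ≡⟨ cong (relabelT σ) (toTree-relabel (fromTree t) (fromTree-wf t wft)
                                           (strictlyMonotoneOn-⊆ (∈-++⁺ˡ ∘ fromTree-⊆ t wft) π-mono)) ⟩
    relabelT σ (relabelT π (toTree (fromTree t))) ≡⟨ cong (relabelT σ ∘ relabelT π) (toTree-fromTree t wft) ⟩
    relabelT σ (relabelT π t)                     ≡⟨ relabelT-∘ π σ t ⟩
    relabelT (σ ∘ π) t                            ≡⟨ relabelT-cong t (σ∘π≗id ∘ ∈-++⁺ˡ) ⟩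
    relabelT id t                                 ≡⟨ relabelT-id t ⟩
    t                                             ∎

length-toTrees : ∀ σ Fs → length (toTrees σ Fs) ≡ length Fs
length-toTrees σ [] = refl
length-toTrees σ (F ∷ Fs) = cong suc (length-toTrees σ Fs)

wT-toTree : ∀ φ D → wT φ (toTree D) ≡ wD φ D
wTs-toTrees : ∀ φ σ Fs → wTs φ (toTrees σ Fs) ≡ wDs φ Fs
wT-toTree φ (single a) = refl
wT-toTree φ (diamond a b Fs) = cong₂ _*_ (cong φ (length-toTrees _ Fs)) (wTs-toTrees φ _ Fs)
wTs-toTrees φ σ [] = refl
wTs-toTrees φ σ (F ∷ Fs) = cong₂ _*_ (trans (wT-relabel φ σ (toTree F)) (wT-toTree φ F)) (wTs-toTrees φ σ Fs)

IsDiamondOn⇔ : ∀ n D → IsDiamondOn n D ⇔ (WfD D × T (labelSetIs n (labelsD D)))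
IsDiamondOn⇔ n D = (T-wfD D ×-⇔ ⇔-id _) ⇔-∘ T-∧

IsTreeOn⇔ : ∀ n t → IsTreeOn n t ⇔ (WfT t × T (labelSetIs n (labelsT t)))
IsTreeOn⇔ n t = (T-wfT t ×-⇔ ⇔-id _) ⇔-∘ T-∧

toTree-on : ∀ {n} D → IsDiamondOn n D → IsTreeOn n (toTree D)
toTree-on {n} D D-on = let wfD , labels = to (IsDiamondOn⇔ n D) D-on in
  from (IsTreeOn⇔ n (toTree D))
       (toTree-wf D wfD , labelSetIs-⊆ n (sym (length-labelsT-toTree D)) (toTree-⊇ D wfD) labels)

fromTree-on : ∀ {n} t → IsTreeOn n t → IsDiamondOn n (fromTree t)
fromTree-on {n} t t-on = let wft , labels = to (IsTreeOn⇔ n t) t-on in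
  from (IsDiamondOn⇔ n (fromTree t))
       (fromTree-wf t wft , labelSetIs-⊆ n (sym (length-labelsD-fromTree t)) (fromTree-⊇ t wft) labels)

Σ-≡-irrelevant : ∀ {A : Set} {P : A → Set} → (∀ {a} (p q : P a) → p ≡ q) →
                 {x y : Σ A P} → proj₁ x ≡ proj₁ y → x ≡ y
Σ-≡-irrelevant P-irr {a , p} {.a , q} refl = cong (a ,_) (P-irr p q)

𝓕↔𝓣 : ∀ n → 𝓕 n ↔ 𝓣 n
𝓕↔𝓣 n = mk↔ₛ′ (λ (D , D-on) → toTree D , toTree-on D D-on)
              (λ (t , t-on) → fromTree t , fromTree-on t t-on)
              (λ (t , t-on) → Σ-≡-irrelevant T-irrelevant (toTree-fromTree t (proj₁ (to (IsTreeOn⇔ n t) t-on))))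
              (λ (D , D-on) → Σ-≡-irrelevant T-irrelevant (fromTree-toTree D (proj₁ (to (IsDiamondOn⇔ n D) D-on))))

-- The bijection preserves weights for every φ.
mainTheorem2 : (φ : ℕ → ℚ) → (∀ k → 0ℚ ≤ℚ φ k) → 0ℚ <ℚ φ 0 →
    (n : ℕ) → 1 ≤ n →
    Σ (𝓕 n ⤖ 𝓣 n) (λ M →
      ∀ (F : 𝓕 n) → wT φ (proj₁ (Bijection.to M F)) ≡ wD φ (proj₁ F))
mainTheorem2 φ _ _ n _ = ↔⇒⤖ (𝓕↔𝓣 n) , λ (D , _) → wT-toTree φ D
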